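{- For every graph $G$, $\mathrm{copw}_1(G)=\deg(G)+1$, where $\deg(G)$ denotes the degeneracy of $G$.
   Context: Graphs are finite, undirected, without loops. The degeneracy $\deg(G)$ is the least $d$ such that there is a total order on $V(G)$ in which every vertex has at most $d$ neighbors before it. Cops and Robber game of radius $r\in\mathbb N\cup\{\infty\}$ and width $k$ on $G$: there are $k$ cops, each either standing on a vertex or in a helicopter, and a robber standing on a vertex. Initially all cops are in helicopters and the robber chooses a starting vertex. In each round the cops announce a set $X$ of at most $k$ vertices on which they will land; before they land, the robber, knowing $X$, may move from his current vertex along a path of length at most $r$ (possibly of length $0$) that passes through no vertex occupied by a cop that remains on the ground (i.e. no vertex occupied by a cop both before and after the move); then the cops land on $X$. The cops win if a cop lands on the robber's vertex. $\mathrm{copw}_r(G)$ (radius-$r$ cop-width) is the least $k$ such that the cops have a winning strategy in this game. -}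

module Defs where

open import Data.Nat using (ℕ; zero; suc; _≤_; _<ᵇ_)
open import Data.Bool using (Bool; true; false; _∧_; if_then_else_)
open import Data.Fin using (Fin; toℕ)
open import Data.Fin.Subset using (Subset; _∈_; _∉_; ∣_∣; ⊥)
open import Data.Fin.Permutation using (Permutation′; _⟨$⟩ʳ_)
open import Data.List using (List; map; allFin)
open import Data.Nat.ListAction using (sum)
open import Data.Product using (Σ; _×_; _,_)
open import Data.Sum using (_⊎_)
open import Relation.Binary.PropositionalEquality using (_≡_)
open import Relation.Nullary using (¬_)

record Graph (n : ℕ) : Set where
  field
    adj    : Fin n → Fin n → Bool
    sym    : ∀ u v → adj u v ≡ adj v u
    irrefl : ∀ v → adj v v ≡ false
open Graph public

backDeg : ∀ {n} → Graph n → Permutation′ n → Fin n → ℕ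
backDeg {n} G π v =
  sum (map (λ u → if adj G u v ∧ (toℕ (π ⟨$⟩ʳ u) <ᵇ toℕ (π ⟨$⟩ʳ v)) then 1 else 0)
           (allFin n))

HasOrderWithBackDeg : ∀ {n} → Graph n → ℕ → Set
HasOrderWithBackDeg {n} G d = Σ (Permutation′ n) λ π → ∀ v → backDeg G π v ≤ d

IsDegeneracy : ∀ {n} → Graph n → ℕ → Set
IsDegeneracy G d = HasOrderWithBackDeg G d × (∀ d′ → HasOrderWithBackDeg G d′ → d ≤ d′)

-- A vertex is blocked for the robber if a cop stands on it both before (C)
-- and after (X) the move.
Free : ∀ {n} → Subset n → Subset n → Fin n → Set
Free C X u = ¬ (u ∈ C × u ∈ X)

data Reach {n} (G : Graph n) (C X : Subset n) : ℕ → Fin n → Fin n → Set where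
  stay : ∀ {r u} → Free C X u → Reach G C X r u u
  step : ∀ {r u w v} → Free C X u → adj G u w ≡ true →
         Reach G C X r w v → Reach G C X (suc r) u v

-- CopWin G r k C v : with k cops currently on the ground at C and the robber
-- at v, the cops (to move next) have a strategy in the radius-r game that
-- catches the robber after finitely many rounds (inductive = well-founded
-- strategy trees).  In a round the cops announce X (|X| ≤ k); the robber,
-- knowing X, moves to some w reachable as above; cops land on X and win
-- if w ∈ X.
data CopWin {n} (G : Graph n) (r k : ℕ) : Subset n → Fin n → Set where
  round : ∀ {C v} (X : Subset n) → ∣ X ∣ ≤ k →
          (∀ w → Reach G C X r v w → w ∈ X ⊎ CopWin G r k X w) →
          CopWin G r k C v

-- Cops win the game of radius r and width k on G: initially all cops are in
-- helicopters (no cop on the ground) and the robber picks any start vertex.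
CopsWin : ∀ {n} → Graph n → ℕ → ℕ → Set
CopsWin G r k = ∀ v → CopWin G r k ⊥ v

IsCopWidth : ∀ {n} → Graph n → ℕ → ℕ → Set
IsCopWidth G r k = CopsWin G r k × (∀ k′ → CopsWin G r k′ → k ≤ k′)

module Submission where

-- Upper bound: fix an order in which every vertex has at most d earlier neighbours. The d + 1 cops
-- always land on the robber's vertex and its earlier neighbours; a robber of speed 1 must then flee to
-- a later neighbour, so his position in the order strictly increases and he is eventually caught.
-- Lower bound: repeatedly deleting a vertex of degree ≤ k and putting it last in the order either
-- succeeds or gets stuck at a nonempty vertex set inducing minimum degree ≥ k + 1. On such a core,
-- k + 1 cops landing on the robber leave one of his core neighbours free, so he escapes forever;
-- hence k + 1 cops can only win if the degeneracy is at most k.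

open import Defs
open import Data.Nat using (ℕ; zero; suc; _+_; _≤_; _<_; _<ᵇ_; _≤?_; z≤n; s≤s)
open import Data.Nat.Properties
  using (≤-reflexive; ≤-trans; <-≤-trans; +-monoʳ-≤; +-suc; m≤m+n; <⇒≱; <⇒≯; ≤∧≢⇒<; ≮⇒≥; ≰⇒>;
         <ᵇ⇒<; <⇒<ᵇ; module ≤-Reasoning)
open import Data.Bool using (Bool; true; false; _∧_; if_then_else_)
open import Data.Bool.Properties using (T-≡; ∧-conicalˡ; ∧-conicalʳ)
open import Data.Fin using (Fin; zero; suc; toℕ; fromℕ; punchIn; punchOut; _≟_)
open import Data.Fin.Properties using (any?; toℕ<n; toℕ-injective; toℕ-fromℕ; punchIn-punchOut)
open import Data.Fin.Subset
  using (Subset; inside; outside; _∈_; _∉_; _⊆_; ∣_∣; ⊤; ⁅_⁆; _∪_; _∩_)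
open import Data.Fin.Subset.Properties
  using (_∈?_; ∉⊥; ∈⊤; x∈⁅x⁆; ∣⁅x⁆∣≡1; ∣p∣≤∣x∷p∣; p⊆q⇒∣p∣≤∣q∣; p⊂q⇒∣p∣<∣q∣;
         x∈p∩q⁺; x∈p∩q⁻; x∈p∪q⁺)
open import Data.Fin.Permutation using (Permutation′; _⟨$⟩ʳ_; insert; insert-punchIn) renaming (id to idₚ)
open import Data.Vec using (_∷_; []; tabulate; insertAt; here; there)
open import Data.Vec.Properties using (lookup⇒[]=; []=⇒lookup; lookup∘tabulate)
import Data.List as List
open import Data.List.Properties using (map-tabulate)
open import Data.Nat.ListAction using (sum)
open import Data.Product using (∃; _×_; _,_; proj₁; proj₂)
open import Data.Sum using (_⊎_; inj₁; inj₂)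
open import Data.Empty using (⊥-elim)
open import Function using (_∘_; Injection; Equivalence)
open import Function.Properties.Inverse using (↔⇒↣)
open import Relation.Binary.PropositionalEquality
  using (_≡_; _≢_; refl; trans; cong; cong₂; subst₂; module ≡-Reasoning) renaming (sym to ≡-sym)
open import Relation.Nullary using (¬_; yes; no; contradiction)
open import Relation.Nullary.Decidable using (_×-dec_; ¬?; decidable-stable)

private
  variable
    n : ℕ

∣p∪q∣≤∣p∣+∣q∣ : ∀ (p q : Subset n) → ∣ p ∪ q ∣ ≤ ∣ p ∣ + ∣ q ∣
∣p∪q∣≤∣p∣+∣q∣ []            []            = z≤n
∣p∪q∣≤∣p∣+∣q∣ (inside  ∷ p) (s ∷ q)       = s≤s (≤-trans (∣p∪q∣≤∣p∣+∣q∣ p q) (+-monoʳ-≤ ∣ p ∣ (∣p∣≤∣x∷p∣ s q)))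
∣p∪q∣≤∣p∣+∣q∣ (outside ∷ p) (outside ∷ q) = ∣p∪q∣≤∣p∣+∣q∣ p q
∣p∪q∣≤∣p∣+∣q∣ (outside ∷ p) (inside  ∷ q) =
  ≤-trans (s≤s (∣p∪q∣≤∣p∣+∣q∣ p q)) (≤-reflexive (≡-sym (+-suc ∣ p ∣ ∣ q ∣)))

⊆⊎∃∉ : ∀ (p q : Subset n) → p ⊆ q ⊎ ∃ λ x → x ∈ p × x ∉ q
⊆⊎∃∉ p q with any? (λ x → x ∈? p ×-dec ¬? (x ∈? q))
... | yes (x , x∈p , x∉q) = inj₂ (x , x∈p , x∉q)
... | no ∄x = inj₁ λ {x} x∈p → decidable-stable (x ∈? q) (λ x∉q → ∄x (x , x∈p , x∉q))

∈-tabulate⁺ : ∀ (f : Fin n → Bool) {x} → f x ≡ true → x ∈ tabulate f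
∈-tabulate⁺ f {x} fx = lookup⇒[]= x (tabulate f) (trans (lookup∘tabulate f x) fx)

∈-tabulate⁻ : ∀ (f : Fin n → Bool) {x} → x ∈ tabulate f → f x ≡ true
∈-tabulate⁻ f {x} x∈ = trans (≡-sym (lookup∘tabulate f x)) ([]=⇒lookup x∈)

∣insertAt-outside∣ : ∀ (p : Subset n) i → ∣ insertAt p i outside ∣ ≡ ∣ p ∣
∣insertAt-outside∣ p             zero    = refl
∣insertAt-outside∣ (inside  ∷ p) (suc i) = cong suc (∣insertAt-outside∣ p i)
∣insertAt-outside∣ (outside ∷ p) (suc i) = ∣insertAt-outside∣ p i

∈-insertAt⁺ : ∀ {p : Subset n} i {j} b → j ∈ p → punchIn i j ∈ insertAt p i b
∈-insertAt⁺ zero    b j∈p         = there j∈p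
∈-insertAt⁺ (suc i) b here        = here
∈-insertAt⁺ (suc i) b (there j∈p) = there (∈-insertAt⁺ i b j∈p)

∈-insertAt-outside⁻ : ∀ (p : Subset n) i {x} → x ∈ insertAt p i outside → ∃ λ j → punchIn i j ≡ x × j ∈ p
∈-insertAt-outside⁻ p       zero    (there j∈p) = _ , refl , j∈p
∈-insertAt-outside⁻ (_ ∷ p) (suc i) here        = zero , refl , here
∈-insertAt-outside⁻ (_ ∷ p) (suc i) (there x∈)  with ∈-insertAt-outside⁻ p i x∈
... | j , refl , j∈p = suc j , refl , there j∈p

punchIn-or-self : ∀ (i x : Fin (suc n)) → x ≡ i ⊎ ∃ λ j → punchIn i j ≡ x
punchIn-or-self i x with i ≟ x
... | yes refl = inj₁ refl
... | no  i≢x  = inj₂ (punchOut i≢x , punchIn-punchOut i≢x)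

∣tabulate∣≡sum : ∀ (f : Fin n → Bool) → ∣ tabulate f ∣ ≡ sum (List.tabulate (λ x → if f x then 1 else 0))
∣tabulate∣≡sum {zero}  f = refl
∣tabulate∣≡sum {suc n} f with f zero
... | true  = cong suc (∣tabulate∣≡sum (f ∘ suc))
... | false = ∣tabulate∣≡sum (f ∘ suc)

neighbours : Graph n → Fin n → Subset n
neighbours G v = tabulate (adj G v)

∉-neighbours-self : ∀ (G : Graph n) v → v ∉ neighbours G v
∉-neighbours-self G v v∈ = contradiction (trans (≡-sym (irrefl G v)) (∈-tabulate⁻ (adj G v) v∈)) λ ()

position : Permutation′ n → Fin n → ℕ
position π u = toℕ (π ⟨$⟩ʳ u)

position-injective : ∀ (π : Permutation′ n) {u v} → position π u ≡ position π v → u ≡ v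
position-injective π = Injection.injective (↔⇒↣ π) ∘ toℕ-injective

isEarlierNeighbour : Graph n → Permutation′ n → Fin n → Fin n → Bool
isEarlierNeighbour G π v u = adj G u v ∧ (position π u <ᵇ position π v)

earlierNeighbours : Graph n → Permutation′ n → Fin n → Subset n
earlierNeighbours G π v = tabulate (isEarlierNeighbour G π v)

backDeg≡∣earlierNeighbours∣ : ∀ (G : Graph n) π v → backDeg G π v ≡ ∣ earlierNeighbours G π v ∣
backDeg≡∣earlierNeighbours∣ G π v = begin
  sum (List.map indicator (List.allFin _)) ≡⟨ cong sum (map-tabulate (λ u → u) indicator) ⟩
  sum (List.tabulate indicator)            ≡⟨ ≡-sym (∣tabulate∣≡sum (isEarlierNeighbour G π v)) ⟩
  ∣ earlierNeighbours G π v ∣              ∎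
  where
  open ≡-Reasoning
  indicator : Fin _ → ℕ
  indicator u = if isEarlierNeighbour G π v u then 1 else 0

earlierNeighbours⊆neighbours : ∀ (G : Graph n) π v → earlierNeighbours G π v ⊆ neighbours G v
earlierNeighbours⊆neighbours G π v {u} u∈ =
  ∈-tabulate⁺ (adj G v) (trans (sym G v u) (∧-conicalˡ _ _ (∈-tabulate⁻ (isEarlierNeighbour G π v) u∈)))

removeVertex : Fin (suc n) → Graph (suc n) → Graph n
removeVertex x G = record
  { adj    = λ i j → adj G (punchIn x i) (punchIn x j)
  ; sym    = λ i j → sym G (punchIn x i) (punchIn x j)
  ; irrefl = λ i → irrefl G (punchIn x i)
  }

record Core (G : Graph n) (k : ℕ) : Set where
  field
    vertices : Subset n
    nonempty : ∃ λ v → v ∈ vertices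
    dense    : ∀ {v} → v ∈ vertices → k ≤ ∣ vertices ∩ neighbours G v ∣

⊤-core : ∀ {G : Graph (suc n)} {k} → (∀ v → k ≤ ∣ neighbours G v ∣) → Core G k
⊤-core {G = G} k≤deg = record
  { vertices = ⊤
  ; nonempty = zero , ∈⊤
  ; dense    = λ {v} _ → ≤-trans (k≤deg v) (p⊆q⇒∣p∣≤∣q∣ {p = neighbours G v} (λ u∈N → x∈p∩q⁺ (∈⊤ , u∈N)))
  }

module Chase (G : Graph n) {k bound : ℕ} (guard : Fin n → Subset n) (rank : Fin n → ℕ)
             (∣guard∣≤k : ∀ v → ∣ guard v ∣ ≤ k) (v∈guard : ∀ v → v ∈ guard v)
             (rank<bound : ∀ v → rank v < bound)
             (escape-raises-rank : ∀ {v w} → adj G v w ≡ true → w ∉ guard v → rank v < rank w) where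

  chase : ∀ fuel {C v} → bound ≤ fuel + rank v → CopWin G 1 k C v
  chase fuel {C} {v} enough = round (guard v) (∣guard∣≤k v) respond
    where
    continue : ∀ fuel {w} → bound ≤ fuel + rank v → rank v < rank w → CopWin G 1 k (guard v) w
    continue zero    enough′ _   = ⊥-elim (<⇒≱ (rank<bound v) enough′)
    continue (suc f) enough′ v<w =
      chase f (≤-trans enough′ (≤-trans (≤-reflexive (≡-sym (+-suc f (rank v)))) (+-monoʳ-≤ f v<w)))

    respond : ∀ w → Reach G C (guard v) 1 v w → w ∈ guard v ⊎ CopWin G 1 k (guard v) w
    respond v (stay _) = inj₁ (v∈guard v)
    respond w (step _ v~w (stay _)) with w ∈? guard v
    ... | yes w∈guard = inj₁ w∈guard
    ... | no  w∉guard = inj₂ (continue fuel enough (escape-raises-rank v~w w∉guard))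

  copsWin : CopsWin G 1 k
  copsWin v = chase bound (m≤m+n bound (rank v))

copsWin-byOrder : ∀ (G : Graph n) {d} → HasOrderWithBackDeg G d → CopsWin G 1 (suc d)
copsWin-byOrder {n} G {d} (π , backDeg≤d) =
  Chase.copsWin G guard (position π) ∣guard∣≤1+d v∈guard (λ v → toℕ<n (π ⟨$⟩ʳ v)) escape-is-later
  where
  guard : Fin n → Subset n
  guard v = ⁅ v ⁆ ∪ earlierNeighbours G π v

  ∣guard∣≤1+d : ∀ v → ∣ guard v ∣ ≤ suc d
  ∣guard∣≤1+d v = begin
    ∣ ⁅ v ⁆ ∪ earlierNeighbours G π v ∣     ≤⟨ ∣p∪q∣≤∣p∣+∣q∣ ⁅ v ⁆ _ ⟩
    ∣ ⁅ v ⁆ ∣ + ∣ earlierNeighbours G π v ∣ ≡⟨ cong₂ _+_ (∣⁅x⁆∣≡1 v) (≡-sym (backDeg≡∣earlierNeighbours∣ G π v)) ⟩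
    suc (backDeg G π v)                     ≤⟨ s≤s (backDeg≤d v) ⟩
    suc d                                   ∎
    where open ≤-Reasoning

  v∈guard : ∀ v → v ∈ guard v
  v∈guard v = x∈p∪q⁺ (inj₁ (x∈⁅x⁆ v))

  escape-is-later : ∀ {v w} → adj G v w ≡ true → w ∉ guard v → position π v < position π w
  escape-is-later {v} {w} v~w w∉guard = ≤∧≢⇒< (≮⇒≥ w-not-earlier) (v≢w ∘ position-injective π)
    where
    w-not-earlier : ¬ position π w < position π v
    w-not-earlier w<v = w∉guard (x∈p∪q⁺ (inj₂ (∈-tabulate⁺ (isEarlierNeighbour G π v)
      (cong₂ _∧_ (trans (sym G w v) v~w) (Equivalence.to T-≡ (<⇒<ᵇ w<v))))))
    v≢w : v ≢ w
    v≢w refl = contradiction (trans (≡-sym v~w) (irrefl G v)) λ ()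

module _ {G : Graph n} {k : ℕ} (core : Core G k) where
  open Core core

  core-escape : ∀ {v X} → v ∈ vertices → v ∈ X → ∣ X ∣ ≤ k →
                ∃ λ u → u ∈ vertices × adj G v u ≡ true × u ∉ X
  core-escape {v} {X} v∈P v∈X ∣X∣≤k with ⊆⊎∃∉ (vertices ∩ neighbours G v) X
  ... | inj₁ N⊆X =
    contradiction (dense v∈P) (<⇒≱ (<-≤-trans (p⊂q⇒∣p∣<∣q∣ (N⊆X , v , v∈X , v∉N)) ∣X∣≤k))
    where
    v∉N : v ∉ vertices ∩ neighbours G v
    v∉N = ∉-neighbours-self G v ∘ proj₂ ∘ x∈p∩q⁻ vertices (neighbours G v)
  ... | inj₂ (u , u∈P∩N , u∉X) with x∈p∩q⁻ vertices (neighbours G v) u∈P∩N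
  ...   | u∈P , u∈N = u , u∈P , ∈-tabulate⁻ (adj G v) u∈N , u∉X

  mutual
    evade : ∀ {C v} → v ∈ vertices → v ∉ C → ¬ CopWin G 1 k C v
    evade {C} {v} v∈P v∉C (round X ∣X∣≤k respond) with v ∈? X
    ... | no v∉X = survive v∈P v∉X (respond v (stay (v∉X ∘ proj₂)))
    ... | yes v∈X with core-escape v∈P v∈X ∣X∣≤k
    ...   | u , u∈P , v~u , u∉X =
      survive u∈P u∉X (respond u (step (v∉C ∘ proj₁) v~u (stay (u∉X ∘ proj₂))))

    survive : ∀ {X u} → u ∈ vertices → u ∉ X → ¬ (u ∈ X ⊎ CopWin G 1 k X u)
    survive _   u∉X (inj₁ u∈X) = u∉X u∈X
    survive u∈P u∉X (inj₂ win) = evade u∈P u∉X win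

  core⇒¬copsWin : ¬ CopsWin G 1 k
  core⇒¬copsWin win = evade (proj₂ nonempty) ∉⊥ (win (proj₁ nonempty))

core-removeVertex : ∀ (G : Graph (suc n)) x {k} → Core (removeVertex x G) k → Core G k
core-removeVertex G x {k} core′ = record
  { vertices = P
  ; nonempty = punchIn x (proj₁ nonempty′) , ∈-insertAt⁺ x outside (proj₂ nonempty′)
  ; dense    = dense
  }
  where
  open Core core′ renaming (vertices to P′; nonempty to nonempty′; dense to dense′)
  G′ : Graph _
  G′ = removeVertex x G
  P : Subset _
  P = insertAt P′ x outside

  dense : ∀ {v} → v ∈ P → k ≤ ∣ P ∩ neighbours G v ∣
  dense v∈P with ∈-insertAt-outside⁻ P′ x v∈P
  ... | j , refl , j∈P′ = begin
    k                                             ≤⟨ dense′ j∈P′ ⟩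
    ∣ P′ ∩ neighbours G′ j ∣                      ≡⟨ ≡-sym (∣insertAt-outside∣ _ x) ⟩
    ∣ insertAt (P′ ∩ neighbours G′ j) x outside ∣ ≤⟨ p⊆q⇒∣p∣≤∣q∣ lift⊆ ⟩
    ∣ P ∩ neighbours G (punchIn x j) ∣            ∎
    where
    open ≤-Reasoning
    lift⊆ : insertAt (P′ ∩ neighbours G′ j) x outside ⊆ P ∩ neighbours G (punchIn x j)
    lift⊆ u∈ with ∈-insertAt-outside⁻ _ x u∈
    ... | i , refl , i∈ with x∈p∩q⁻ P′ (neighbours G′ j) i∈
    ...   | i∈P′ , i∈N′ =
      x∈p∩q⁺ (∈-insertAt⁺ x outside i∈P′ , ∈-tabulate⁺ (adj G (punchIn x j)) (∈-tabulate⁻ (adj G′ j) i∈N′))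

insert-self : ∀ i j (π : Permutation′ n) → insert i j π ⟨$⟩ʳ i ≡ j
insert-self i j π with i ≟ i
... | yes _   = refl
... | no  i≢i = contradiction refl i≢i

toℕ-punchIn-fromℕ : ∀ (k : Fin n) → toℕ (punchIn (fromℕ n) k) ≡ toℕ k
toℕ-punchIn-fromℕ zero    = refl
toℕ-punchIn-fromℕ (suc k) = cong suc (toℕ-punchIn-fromℕ k)

order-insertLast : ∀ (G : Graph (suc n)) x {d} → ∣ neighbours G x ∣ ≤ d →
                   HasOrderWithBackDeg (removeVertex x G) d → HasOrderWithBackDeg G d
order-insertLast {n} G x {d} deg≤d (π′ , backDeg′≤d) = π , backDeg≤d
  where
  G′ : Graph n
  G′ = removeVertex x G
  π : Permutation′ (suc n)
  π = insert x (fromℕ n) π′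

  position-x : position π x ≡ n
  position-x = trans (cong toℕ (insert-self x (fromℕ n) π′)) (toℕ-fromℕ n)

  position-punchIn : ∀ i → position π (punchIn x i) ≡ position π′ i
  position-punchIn i = trans (cong toℕ (insert-punchIn x (fromℕ n) π′ i)) (toℕ-punchIn-fromℕ (π′ ⟨$⟩ʳ i))

  x-is-last : ∀ j → ¬ position π x < position π (punchIn x j)
  x-is-last j x<j = <⇒≯ (toℕ<n (π′ ⟨$⟩ʳ j)) (subst₂ _<_ position-x (position-punchIn j) x<j)

  earlier⊆lift : ∀ j → earlierNeighbours G π (punchIn x j) ⊆ insertAt (earlierNeighbours G′ π′ j) x outside
  earlier⊆lift j {u} u∈ with punchIn-or-self x u | ∈-tabulate⁻ (isEarlierNeighbour G π (punchIn x j)) u∈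
  ... | inj₁ refl       | x-earlier =
    ⊥-elim (x-is-last j (<ᵇ⇒< _ _ (Equivalence.from T-≡ (∧-conicalʳ _ _ x-earlier))))
  ... | inj₂ (i , refl) | i-earlier = ∈-insertAt⁺ x outside (∈-tabulate⁺ (isEarlierNeighbour G′ π′ j) (begin
    adj G′ i j ∧ (position π′ i <ᵇ position π′ j)                         ≡⟨ cong (adj G′ i j ∧_) positions ⟩
    adj G′ i j ∧ (position π (punchIn x i) <ᵇ position π (punchIn x j))   ≡⟨ i-earlier ⟩
    true                                                                  ∎))
    where
    open ≡-Reasoning
    positions : (position π′ i <ᵇ position π′ j) ≡ (position π (punchIn x i) <ᵇ position π (punchIn x j))
    positions = ≡-sym (cong₂ _<ᵇ_ (position-punchIn i) (position-punchIn j))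

  backDeg≤d : ∀ v → backDeg G π v ≤ d
  backDeg≤d v with punchIn-or-self x v
  ... | inj₁ refl = begin
    backDeg G π x                    ≡⟨ backDeg≡∣earlierNeighbours∣ G π x ⟩
    ∣ earlierNeighbours G π x ∣      ≤⟨ p⊆q⇒∣p∣≤∣q∣ (earlierNeighbours⊆neighbours G π x) ⟩
    ∣ neighbours G x ∣               ≤⟨ deg≤d ⟩
    d                                ∎
    where open ≤-Reasoning
  ... | inj₂ (j , refl) = begin
    backDeg G π (punchIn x j)                          ≡⟨ backDeg≡∣earlierNeighbours∣ G π (punchIn x j) ⟩
    ∣ earlierNeighbours G π (punchIn x j) ∣            ≤⟨ p⊆q⇒∣p∣≤∣q∣ (earlier⊆lift j) ⟩
    ∣ insertAt (earlierNeighbours G′ π′ j) x outside ∣ ≡⟨ ∣insertAt-outside∣ _ x ⟩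
    ∣ earlierNeighbours G′ π′ j ∣                      ≡⟨ ≡-sym (backDeg≡∣earlierNeighbours∣ G′ π′ j) ⟩
    backDeg G′ π′ j                                    ≤⟨ backDeg′≤d j ⟩
    d                                                  ∎
    where open ≤-Reasoning

order⊎core : ∀ (G : Graph n) d → HasOrderWithBackDeg G d ⊎ Core G (suc d)
order⊎core {zero}  G d = inj₁ (idₚ , λ ())
order⊎core {suc n} G d with any? (λ x → ∣ neighbours G x ∣ ≤? d)
... | no ∄low = inj₂ (⊤-core (λ v → ≰⇒> (λ low → ∄low (v , low))))
... | yes (x , low) with order⊎core (removeVertex x G) d
...   | inj₁ order = inj₁ (order-insertLast G x low order)
...   | inj₂ core  = inj₂ (core-removeVertex G x core)

mainTheorem1 : ∀ (m : ℕ) (G : Graph (suc m)) (d : ℕ) →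
    IsDegeneracy G d → IsCopWidth G 1 (suc d)
mainTheorem1 m G d (order , minimal) = copsWin-byOrder G order , width≥1+d
  where
  width≥1+d : ∀ k → CopsWin G 1 k → suc d ≤ k
  width≥1+d zero    win = ⊥-elim (core⇒¬copsWin (⊤-core {G = G} (λ _ → z≤n)) win)
  width≥1+d (suc k) win with order⊎core G k
  ... | inj₁ order′ = s≤s (minimal k order′)
  ... | inj₂ core   = ⊥-elim (core⇒¬copsWin core win)
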